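{- Every approximate sorting algorithm in the adversarial comparator model is gap-preserving.
   Context: Adversarial comparator model: given items with unknown real values, the algorithm accesses them only via a comparator which, for items $x_i,x_j$, returns $\max\{x_i,x_j\}$ if $|x_i-x_j|>1$ and otherwise either one as chosen by an adversary. For reals write $a\ge_k b$ if $a\ge b-k$; an ordering $y_1,\dots,y_n$ of the items is a $k$-approximate sorting if $y_j\ge_k y_i$ for all $j>i$. An approximate sorting algorithm is one for which there is a function $\tau$ such that on every input of size $n$ (and against every adversary) it returns a $\tau(n)$-approximate sorting. A sorting algorithm is gap-preserving if, whenever the input $X$ admits a real $y$ with $X\cap[y,y+1)=\emptyset$, the algorithm outputs all elements of $X$ less than $y$ before all elements of $X$ greater than $y$. -}

module Defs where

open import Level using (0ℓ)
open import Data.Nat using (ℕ)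
open import Data.Fin using (Fin)
import Data.Fin as Fin
open import Data.Fin.Permutation using (Permutation′; _⟨$⟩ʳ_)
open import Data.Product using (Σ; _×_; ∃)
open import Data.Sum using (_⊎_)
open import Relation.Nullary using (¬_)
open import Relation.Binary.PropositionalEquality using (_≡_)
open import Relation.Binary.Structures using (IsStrictTotalOrder)
open import Algebra.Structures using (IsCommutativeRing)

-- The real numbers, axiomatised as a (Dedekind-)complete ordered field.
-- (Every such structure is isomorphic to ℝ, so quantifying over all of
-- them is the same as speaking about ℝ.)

record RealField : Set₁ where
  infixl 6 _+_
  infixl 7 _*_
  infix  4 _<_ _≤_
  field
    Carrier : Set
    _+_ _*_ : Carrier → Carrier → Carrier
    -_      : Carrier → Carrier
    0# 1#   : Carrier
    _<_     : Carrier → Carrier → Set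
    isCommutativeRing : IsCommutativeRing _≡_ _+_ _*_ -_ 0# 1#
    0≢1     : ¬ (0# ≡ 1#)
    inverse : ∀ a → ¬ (a ≡ 0#) → ∃ λ b → a * b ≡ 1#
    isStrictTotalOrder : IsStrictTotalOrder _≡_ _<_
    +-mono-< : ∀ {a b} c → a < b → a + c < b + c
    *-pos    : ∀ {a b} → 0# < a → 0# < b → 0# < a * b

  _≤_ : Carrier → Carrier → Set
  a ≤ b = (a < b) ⊎ (a ≡ b)

  _-_ : Carrier → Carrier → Carrier
  a - b = a + (- b)

  field
    sup : (P : Carrier → Set) → ∃ P → (∃ λ u → ∀ a → P a → a ≤ u) →
          ∃ λ s → (∀ a → P a → a ≤ s) × (∀ u → (∀ a → P a → a ≤ u) → s ≤ u)

module _ (ℝ : RealField) where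
  open RealField ℝ

  -- Deterministic comparison-based algorithms on n items (indexed by
  -- Fin n) as decision trees: a node compares items i and j and
  -- continues according to the item k returned by the comparator; a
  -- leaf outputs an ordering of the items (position ↦ item).

  data Tree (n : ℕ) : Set where
    leaf : Permutation′ n → Tree n
    cmp  : (i j : Fin n) → (Fin n → Tree n) → Tree n

  Algorithm : Set
  Algorithm = (n : ℕ) → Tree n

  Answer : ∀ {n} → (Fin n → Carrier) → Fin n → Fin n → Fin n → Set
  Answer x i j k = (k ≡ i × ¬ (x i + 1# < x j)) ⊎ (k ≡ j × ¬ (x j + 1# < x i))

  -- Outputs x t σ : some adversary makes tree t output σ on input x.
  data Outputs {n : ℕ} (x : Fin n → Carrier) : Tree n → Permutation′ n → Set where
    out-leaf : ∀ σ → Outputs x (leaf σ) σ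
    out-cmp  : ∀ {i j f σ} k → Answer x i j k → Outputs x (f k) σ →
               Outputs x (cmp i j f) σ

  _≥[_]_ : Carrier → Carrier → Carrier → Set
  a ≥[ k ] b = b - k ≤ a

  IsApproxSorting : ∀ {n} → Carrier → (Fin n → Carrier) → Permutation′ n → Set
  IsApproxSorting k x σ =
    ∀ p q → p Fin.< q → x (σ ⟨$⟩ʳ q) ≥[ k ] x (σ ⟨$⟩ʳ p)

  IsApproxSortingAlgorithm : Algorithm → Set
  IsApproxSortingAlgorithm A =
    Σ (ℕ → Carrier) λ τ → ∀ n (x : Fin n → Carrier) σ →
      Outputs x (A n) σ → IsApproxSorting (τ n) x σ

  IsGapPreserving : Algorithm → Set
  IsGapPreserving A =
    ∀ n (x : Fin n → Carrier) σ → Outputs x (A n) σ →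
    ∀ y → (∀ i → ¬ (y ≤ x i × x i < y + 1#)) →
    ∀ p q → x (σ ⟨$⟩ʳ p) < y → y < x (σ ⟨$⟩ʳ q) → p Fin.< q

{-# OPTIONS --safe #-}
-- Suppose no value lies in [y, y+1). Raise every item above the gap by some m ≥ max(τ(n), 0).
-- Every comparison the comparator is forced to resolve on the raised input was already forced,
-- the same way, on the original one, so any run of the algorithm on the original input is also
-- a legal run on the raised input and produces the same ordering. That ordering must therefore be
-- a τ(n)-approximate sorting of the raised input, where every item above the gap exceeds every
-- item below it by more than τ(n); so no item above the gap can be placed before one below it.
module Submission where

open import Defs
open import Data.Fin using (Fin)
open import Data.Fin.Properties using (<-cmp)
open import Data.Fin.Permutation using (_⟨$⟩ʳ_)
open import Data.Product using (∃; _×_; _,_)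
open import Data.Sum using (_⊎_; inj₁; inj₂; [_,_]′)
open import Data.Empty using (⊥-elim)
open import Function.Base using (id; const; _∘_)
open import Relation.Nullary using (¬_)
open import Relation.Binary.PropositionalEquality
  using (_≡_; refl; sym; trans; subst; subst₂; isEquivalence)
open import Relation.Binary.Definitions using (tri<; tri≈; tri>)
open import Relation.Binary.Structures using (IsStrictTotalOrder)
open import Algebra.Bundles using (CommutativeRing)
import Algebra.Properties.Ring as RingProperties
import Algebra.Properties.Group as GroupProperties
import Algebra.Properties.CommutativeSemigroup as CommutativeSemigroupProperties
import Relation.Binary.Construct.StrictToNonStrict as StrictToNonStrict

module OrderedFieldProperties (ℝ : RealField) where
  open RealField ℝ
  open IsStrictTotalOrder isStrictTotalOrder public
    using (compare) renaming (trans to <-trans; asym to <-asym)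
  open IsStrictTotalOrder isStrictTotalOrder using (irrefl; <-resp-≈; <-respʳ-≈; <-respˡ-≈)

  commutativeRing : CommutativeRing _ _
  commutativeRing = record { isCommutativeRing = isCommutativeRing }

  open CommutativeRing commutativeRing
    using (+-comm; +-identityˡ; +-identityʳ; -‿inverseʳ; +-group; +-commutativeSemigroup)
  open RingProperties (CommutativeRing.ring commutativeRing) using (-1*x≈-x; -‿involutive)
  open GroupProperties +-group using (//-rightDividesˡ; //-rightDividesʳ)
  open CommutativeSemigroupProperties +-commutativeSemigroup using (xy∙z≈xz∙y)

  <-irrefl : ∀ {a} → ¬ (a < a)
  <-irrefl = irrefl refl

  ≤-trans : ∀ {a b c} → a ≤ b → b ≤ c → a ≤ c
  ≤-trans = StrictToNonStrict.trans _≡_ _<_ isEquivalence <-resp-≈ <-trans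

  <-≤-trans : ∀ {a b c} → a < b → b ≤ c → a < c
  <-≤-trans = StrictToNonStrict.<-≤-trans _≡_ _<_ <-trans <-respʳ-≈

  ≤-<-trans : ∀ {a b c} → a ≤ b → b < c → a < c
  ≤-<-trans = StrictToNonStrict.≤-<-trans _≡_ _<_ sym <-trans <-respˡ-≈

  ≮⇒≥ : ∀ {a b} → ¬ (a < b) → b ≤ a
  ≮⇒≥ {a} {b} a≮b with compare a b
  ... | tri< a<b _ _ = ⊥-elim (a≮b a<b)
  ... | tri≈ _ a≡b _ = inj₂ (sym a≡b)
  ... | tri> _ _ b<a = inj₁ b<a

  +-monoˡ-≤ : ∀ {a b} c → a ≤ b → a + c ≤ b + c
  +-monoˡ-≤ c (inj₁ a<b) = inj₁ (+-mono-< c a<b)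
  +-monoˡ-≤ c (inj₂ refl) = inj₂ refl

  +-monoʳ-< : ∀ {a b} c → a < b → c + a < c + b
  +-monoʳ-< {a} {b} c a<b = subst₂ _<_ (+-comm a c) (+-comm b c) (+-mono-< c a<b)

  +-monoʳ-≤ : ∀ {a b} c → a ≤ b → c + a ≤ c + b
  +-monoʳ-≤ c (inj₁ a<b) = inj₁ (+-monoʳ-< c a<b)
  +-monoʳ-≤ c (inj₂ refl) = inj₂ refl

  +-cancelʳ-< : ∀ {a b} c → a + c < b + c → a < b
  +-cancelʳ-< {a} {b} c a+c<b+c =
    subst₂ _<_ (//-rightDividesʳ c a) (//-rightDividesʳ c b) (+-mono-< (- c) a+c<b+c)

  -- If 1 < 0 then 0 < -1, and then 0 < (-1)(-1) = 1.
  0<1 : 0# < 1#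
  0<1 with compare 0# 1#
  ... | tri< 0<1 _ _ = 0<1
  ... | tri≈ _ 0≡1 _ = ⊥-elim (0≢1 0≡1)
  ... | tri> _ _ 1<0 = ⊥-elim (<-asym 1<0 0<[-1][-1])
    where
      0<-1 : 0# < - 1#
      0<-1 = subst₂ _<_ (-‿inverseʳ 1#) (+-identityˡ (- 1#)) (+-mono-< (- 1#) 1<0)
      0<[-1][-1] : 0# < 1#
      0<[-1][-1] = subst (0# <_) (trans (-1*x≈-x (- 1#)) (-‿involutive 1#)) (*-pos 0<-1 0<-1)

  a<a+1 : ∀ a → a < a + 1#
  a<a+1 a = subst (_< a + 1#) (+-identityʳ a) (+-monoʳ-< a 0<1)

  a≤a+m : ∀ a {m} → 0# ≤ m → a ≤ a + m
  a≤a+m a 0≤m = subst (_≤ a + _) (+-identityʳ a) (+-monoʳ-≤ a 0≤m)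

  a+k<b⇒b-k≰a : ∀ {a b k} → a + k < b → ¬ (b - k ≤ a)
  a+k<b⇒b-k≰a {a} {b} {k} a+k<b b-k≤a =
    <-irrefl (≤-<-trans (subst (_≤ a + k) (//-rightDividesˡ k b) (+-monoˡ-≤ k b-k≤a)) a+k<b)

  a+m+1≡a+1+m : ∀ a m → (a + m) + 1# ≡ (a + 1#) + m
  a+m+1≡a+1+m a m = xy∙z≈xz∙y a m 1#

  ∃-nonnegative-upper-bound : ∀ a → ∃ λ m → 0# ≤ m × a ≤ m
  ∃-nonnegative-upper-bound a with compare a 0#
  ... | tri< a<0 _ _ = 0# , inj₂ refl , inj₁ a<0
  ... | tri≈ _ a≡0 _ = a , inj₂ (sym a≡0) , inj₂ refl
  ... | tri> _ _ 0<a = a , inj₁ 0<a , inj₂ refl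

  below⊎above-gap : ∀ {y a} → ¬ (y ≤ a × a < y + 1#) → a < y ⊎ y + 1# ≤ a
  below⊎above-gap {y} {a} a∉gap with compare a y
  ... | tri< a<y _ _ = inj₁ a<y
  ... | tri≈ _ a≡y _ = inj₂ (≮⇒≥ λ a<y+1 → a∉gap (inj₂ (sym a≡y) , a<y+1))
  ... | tri> _ _ y<a = inj₂ (≮⇒≥ λ a<y+1 → a∉gap (inj₁ y<a , a<y+1))

module Comparator (ℝ : RealField) where
  open RealField ℝ
  open OrderedFieldProperties ℝ

  Clear : ∀ {n} → (Fin n → Carrier) → Fin n → Fin n → Set
  Clear x i j = x i + 1# < x j

  module _ {n} {x x′ : Fin n → Carrier} (reflect : ∀ {i j} → Clear x′ i j → Clear x i j) where

    answer-transfer : ∀ {i j k} → Answer ℝ x i j k → Answer ℝ x′ i j k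
    answer-transfer (inj₁ (k≡i , ¬clear)) = inj₁ (k≡i , ¬clear ∘ reflect)
    answer-transfer (inj₂ (k≡j , ¬clear)) = inj₂ (k≡j , ¬clear ∘ reflect)

    outputs-transfer : ∀ {t σ} → Outputs ℝ x t σ → Outputs ℝ x′ t σ
    outputs-transfer (out-leaf σ) = out-leaf σ
    outputs-transfer (out-cmp k answer out) =
      out-cmp k (answer-transfer answer) (outputs-transfer out)

  module RaiseAboveGap {n} (x : Fin n → Carrier) (y : Carrier)
                       (split : ∀ i → x i < y ⊎ y + 1# ≤ x i) {m : Carrier} (0≤m : 0# ≤ m) where

    raise : Fin n → Carrier
    raise i = [ const (x i) , const (x i + m) ]′ (split i)

    raise-reflects-clear : ∀ {i j} → Clear raise i j → Clear x i j
    raise-reflects-clear {i} {j} with split i | split j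
    ... | inj₁ _ | inj₁ _ = id
    ... | inj₁ xi<y | inj₂ y+1≤xj = const (<-≤-trans (+-mono-< 1# xi<y) y+1≤xj)
    ... | inj₂ _ | inj₂ _ = +-cancelʳ-< m ∘ subst (_< x j + m) (a+m+1≡a+1+m (x i) m)
    ... | inj₂ y+1≤xi | inj₁ xj<y = ⊥-elim ∘ <-asym xj<xi+m+1
      where
        xj<xi+m+1 : x j < x i + m + 1#
        xj<xi+m+1 = <-trans xj<y (<-≤-trans (a<a+1 y)
                      (≤-trans y+1≤xi (≤-trans (a≤a+m (x i) 0≤m) (inj₁ (a<a+1 (x i + m))))))

    raise-separates : ∀ {l h} → x l < y → y < x h → raise l + m < raise h
    raise-separates {l} {h} xl<y y<xh with split l | split h
    ... | inj₁ _ | inj₂ _ = +-mono-< m (<-trans xl<y y<xh)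
    ... | inj₁ _ | inj₁ xh<y = ⊥-elim (<-asym xh<y y<xh)
    ... | inj₂ y+1≤xl | _ = ⊥-elim (<-asym xl<y (<-≤-trans (a<a+1 y) y+1≤xl))

lemma3p6 : (ℝ : RealField) → (A : Algorithm ℝ) →
    IsApproxSortingAlgorithm ℝ A → IsGapPreserving ℝ A
lemma3p6 ℝ A (τ , approx) n x σ out y gap p q below above with <-cmp p q
... | tri< p<q _ _ = p<q
... | tri≈ _ refl _ = ⊥-elim (<-asym below above)
  where open OrderedFieldProperties ℝ
... | tri> _ _ q<p with OrderedFieldProperties.∃-nonnegative-upper-bound ℝ (τ n)
...   | m , 0≤m , τ≤m = ⊥-elim (a+k<b⇒b-k≰a separated approx-on-raised)
  where
    open RealField ℝ
    open OrderedFieldProperties ℝ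
    open Comparator ℝ
    open RaiseAboveGap x y (λ i → below⊎above-gap (gap i)) 0≤m
    approx-on-raised : raise (σ ⟨$⟩ʳ q) - τ n ≤ raise (σ ⟨$⟩ʳ p)
    approx-on-raised = approx n raise σ (outputs-transfer raise-reflects-clear out) q p q<p
    separated : raise (σ ⟨$⟩ʳ p) + τ n < raise (σ ⟨$⟩ʳ q)
    separated = ≤-<-trans (+-monoʳ-≤ _ τ≤m) (raise-separates below above)
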